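{- Let $G$ be a bipartite graph with a total order $\prec$ on $V(G)$ and a function $\beta:V(G)\to\{1,2\}$. If $Q$ is a looping walk of $G$ between vertices $u$ and $v$, then $\lambda(Q)+\delta(u,v)$ is an even number.
   Context: A walk $Q=x_1,\ldots,x_r$ has length $|Q|=r-1$ and $\lambda(Q)=|Q|-2\sum_{i=2}^{r-1}(\beta(x_i)-1)$. For sets, $X\prec Y$ means $x\prec y$ for all $x\in X,y\in Y$. Looping walks are defined recursively: a walk $x_1,\ldots,x_r$ is looping if $x_1\neq x_r$ and, when $r\geq 3$, (i) $\{x_1,x_r\}\prec\{x_2,\ldots,x_{r-1}\}$ and (ii) there is $\ell\notin\{1,r\}$ such that both $x_1,\ldots,x_\ell$ and $x_\ell,\ldots,x_r$ are looping walks (for $r=2$, a looping walk is two distinct adjacent vertices). $\delta(u,v)$ is the minimum of $\lambda(Q)$ over looping walks with endpoints $u,v$ (in either order), $\infty$ if none exists. -}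

module Defs where

open import Data.Nat using (ℕ; zero; suc)
open import Data.Integer using (ℤ; +_; _+_; _-_; _*_; _≤_)
open import Data.Fin using (Fin)
open import Data.Bool using (Bool)
open import Data.List using (List; []; _∷_; _++_; [_]; length)
open import Data.List.Relation.Unary.All using (All)
open import Data.Product using (Σ; ∃; _×_; _,_)
open import Data.Sum using (_⊎_)
open import Relation.Binary.PropositionalEquality using (_≡_; _≢_)
open import Relation.Binary.Structures using (IsStrictTotalOrder)
open import Relation.Nullary using (¬_)

record IsSimpleGraph {n : ℕ} (E : Fin n → Fin n → Set) : Set where
  field
    sym   : ∀ {x y} → E x y → E y x
    irrefl : ∀ {x} → ¬ E x x

IsBipartite : {n : ℕ} → (Fin n → Fin n → Set) → Set
IsBipartite {n} E = Σ (Fin n → Bool) λ c → ∀ x y → E x y → c x ≢ c y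

-- Walks are lists of vertices x₁,…,x_r.
-- interior x₁,…,x_r = x₂,…,x_{r-1}
dropLast : {A : Set} → List A → List A
dropLast [] = []
dropLast (x ∷ []) = []
dropLast (x ∷ y ∷ ys) = x ∷ dropLast (y ∷ ys)

interior : {A : Set} → List A → List A
interior [] = []
interior (x ∷ xs) = dropLast xs

walkLength : {A : Set} → List A → ℕ
walkLength [] = 0
walkLength (x ∷ xs) = length xs

module _ {n : ℕ} (E : Fin n → Fin n → Set) (_≺_ : Fin n → Fin n → Set)
         (β : Fin n → ℕ) where

  sumβ-1 : List (Fin n) → ℤ
  sumβ-1 [] = + 0
  sumβ-1 (x ∷ xs) = (+ β x - + 1) + sumβ-1 xs

  lam : List (Fin n) → ℤ
  lam Q = + walkLength Q - + 2 * sumβ-1 (interior Q)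

  -- Looping walks, as the inductive reading of the recursive definition.
  -- The split case: the walk a,xs,m,ys,c is split at the vertex m
  -- (position ℓ ∉ {1,r}) into the looping walks a,xs,m and m,ys,c.
  data Looping : List (Fin n) → Set where
    edge  : ∀ {x y} → x ≢ y → E x y → Looping (x ∷ y ∷ [])
    split : ∀ {a c m} xs ys →
            a ≢ c →
            All (λ y → (a ≺ y) × (c ≺ y)) (xs ++ m ∷ ys) →
            Looping (a ∷ xs ++ [ m ]) →
            Looping (m ∷ ys ++ [ c ]) →
            Looping (a ∷ xs ++ m ∷ ys ++ [ c ])

  FromTo : List (Fin n) → Fin n → Fin n → Set
  FromTo Q u v = ∃ λ mid → Q ≡ u ∷ mid ++ [ v ]

  Between : List (Fin n) → Fin n → Fin n → Set
  Between Q u v = FromTo Q u v ⊎ FromTo Q v u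

  IsDelta : Fin n → Fin n → ℤ → Set
  IsDelta u v d =
    (∃ λ Q → Looping Q × Between Q u v × lam Q ≡ d) ×
    (∀ Q → Looping Q → Between Q u v → d ≤ lam Q)

-- A looping walk is a concatenation of edges, so in a bipartite graph its length
-- has the parity of the colour difference of its endpoints; hence any two looping
-- walks between u and v have lengths of equal parity. Since λ(Q) differs from |Q|
-- by an even number, λ(Q) + λ(Q′) is even, and δ(u,v) is λ(Q′) for some such Q′.
-- Neither the order ≺ nor the values of β play any role.
module Submission where

open import Defs
open import Data.Nat using (ℕ)
open import Data.Integer using (ℤ; +_; _+_)
open import Data.Integer.Divisibility using (_∣_)
open import Data.Fin using (Fin)
open import Data.List using (List)
open import Data.Sum using (_⊎_)
open import Relation.Binary.PropositionalEquality using (_≡_)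
open import Relation.Binary.Structures using (IsStrictTotalOrder)

open import Data.Bool using (Bool; true; false)
import Data.Nat as ℕ
import Data.Nat.Divisibility as ℕ
open import Data.Nat.Base using (parity)
import Data.Integer as ℤ
open import Data.Integer.Properties using (pos-+)
open import Data.Integer.Divisibility.Signed
  using (∣ᵤ⇒∣; ∣⇒∣ᵤ; ∣-refl; ∣m⇒∣m*n; ∣m∣n⇒∣m-n) renaming (_∣_ to _∣ˢ_)
open import Data.Integer.Tactic.RingSolver using (solve-∀)
open import Data.List using ([]; _∷_; _++_; [_]; length)
open import Data.List.Properties using (∷-injective; ∷ʳ-injective; ++-assoc; length-++)
open import Data.Parity.Base as ℙ using (Parity; 0ℙ; 1ℙ)
open import Data.Parity.Properties using (+-homo-+; p+p≡0ℙ)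
import Data.Parity.Properties as ℙ
open import Data.Product using (_×_; _,_; proj₂)
open import Data.Sum using (inj₁; inj₂)
open import Relation.Binary.PropositionalEquality
  using (_≢_; refl; sym; trans; cong; cong₂; subst; module ≡-Reasoning)

boolToParity : Bool → Parity
boolToParity false = 0ℙ
boolToParity true  = 1ℙ

boolToParity-≢ : ∀ {a b} → a ≢ b → boolToParity a ℙ.+ boolToParity b ≡ 1ℙ
boolToParity-≢ {false} {false} a≢b with () ← a≢b refl
boolToParity-≢ {false} {true}  _   = refl
boolToParity-≢ {true}  {false} _   = refl
boolToParity-≢ {true}  {true}  a≢b with () ← a≢b refl

+-telescope : ∀ p q r → (p ℙ.+ q) ℙ.+ (q ℙ.+ r) ≡ p ℙ.+ r
+-telescope p q r = begin
  (p ℙ.+ q) ℙ.+ (q ℙ.+ r)  ≡⟨ ℙ.+-assoc p q (q ℙ.+ r) ⟩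
  p ℙ.+ (q ℙ.+ (q ℙ.+ r))  ≡⟨ cong (p ℙ.+_) (sym (ℙ.+-assoc q q r)) ⟩
  p ℙ.+ ((q ℙ.+ q) ℙ.+ r)  ≡⟨ cong (λ z → p ℙ.+ (z ℙ.+ r)) (p+p≡0ℙ q) ⟩
  p ℙ.+ r                  ∎
  where open ≡-Reasoning

parity≡0ℙ⇒2∣ : ∀ m → parity m ≡ 0ℙ → 2 ℕ.∣ m
parity≡0ℙ⇒2∣ 0                 _  = 2 ℕ.∣0
parity≡0ℙ⇒2∣ (ℕ.suc (ℕ.suc m)) eq = ℕ.∣m∣n⇒∣m+n ℕ.∣-refl (parity≡0ℙ⇒2∣ m eq)

endpoints-injective : ∀ {A : Set} {u v u′ v′ : A} mid mid′ →
                      u ∷ mid ++ [ v ] ≡ u′ ∷ mid′ ++ [ v′ ] → u ≡ u′ × v ≡ v′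
endpoints-injective mid mid′ eq with u≡u′ , eq′ ← ∷-injective eq =
  u≡u′ , proj₂ (∷ʳ-injective mid mid′ eq′)

length-++-∷ : ∀ {A : Set} (xs : List A) m zs →
              length (xs ++ m ∷ zs) ≡ length (xs ++ [ m ]) ℕ.+ length zs
length-++-∷ xs m zs = trans (cong length (sym (++-assoc xs [ m ] zs))) (length-++ (xs ++ [ m ]))

sub-double-+ : ∀ a b s t →
               (a ℤ.- + 2 ℤ.* s) ℤ.+ (b ℤ.- + 2 ℤ.* t) ≡ (a ℤ.+ b) ℤ.- + 2 ℤ.* (s ℤ.+ t)
sub-double-+ = solve-∀

module _ {n : ℕ} (E : Fin n → Fin n → Set) (_≺_ : Fin n → Fin n → Set) (β : Fin n → ℕ) where

  lam-+-even : ∀ Q Q′ → 2 ℕ.∣ walkLength Q ℕ.+ walkLength Q′ →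
               + 2 ∣ lam E _≺_ β Q + lam E _≺_ β Q′
  lam-+-even Q Q′ 2∣|Q|+|Q′| =
    ∣⇒∣ᵤ (subst (+ 2 ∣ˢ_) (sym lam-sum) (∣m∣n⇒∣m-n 2∣lengths (∣m⇒∣m*n (s ℤ.+ s′) ∣-refl)))
    where
    s s′ : ℤ
    s  = sumβ-1 E _≺_ β (interior Q)
    s′ = sumβ-1 E _≺_ β (interior Q′)
    2∣lengths : + 2 ∣ˢ + (walkLength Q ℕ.+ walkLength Q′)
    2∣lengths = ∣ᵤ⇒∣ 2∣|Q|+|Q′|
    lam-sum : lam E _≺_ β Q + lam E _≺_ β Q′ ≡
              + (walkLength Q ℕ.+ walkLength Q′) ℤ.- + 2 ℤ.* (s ℤ.+ s′)
    lam-sum = trans (sub-double-+ (+ walkLength Q) (+ walkLength Q′) s s′)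
                    (cong (λ z → z ℤ.- + 2 ℤ.* (s ℤ.+ s′)) (sym (pos-+ (walkLength Q) (walkLength Q′))))

  module _ (κ : Fin n → Parity) (κ-proper : ∀ {x y} → E x y → κ x ℙ.+ κ y ≡ 1ℙ) where

    looping-parity : ∀ {Q u v} → Looping E _≺_ β Q → FromTo E _≺_ β Q u v →
                     parity (walkLength Q) ≡ κ u ℙ.+ κ v
    looping-parity (edge _ xy) (mid , eq)
      with refl , refl ← endpoints-injective [] mid eq = sym (κ-proper xy)
    looping-parity (split {a} {c} {m} xs ys _ _ L₁ L₂) (mid , eq)
      with refl , refl ← endpoints-injective (xs ++ m ∷ ys) mid
             (trans (cong (a ∷_) (++-assoc xs (m ∷ ys) [ c ])) eq) = begin
        parity (length (xs ++ m ∷ ys ++ [ c ]))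
          ≡⟨ cong parity (length-++-∷ xs m (ys ++ [ c ])) ⟩
        parity (walkLength (a ∷ xs ++ [ m ]) ℕ.+ walkLength (m ∷ ys ++ [ c ]))
          ≡⟨ +-homo-+ (walkLength (a ∷ xs ++ [ m ])) _ ⟩
        parity (walkLength (a ∷ xs ++ [ m ])) ℙ.+ parity (walkLength (m ∷ ys ++ [ c ]))
          ≡⟨ cong₂ ℙ._+_ (looping-parity L₁ (xs , refl)) (looping-parity L₂ (ys , refl)) ⟩
        (κ a ℙ.+ κ m) ℙ.+ (κ m ℙ.+ κ c)
          ≡⟨ +-telescope (κ a) (κ m) (κ c) ⟩
        κ a ℙ.+ κ c
          ∎
      where open ≡-Reasoning

    looping-parity-between : ∀ {Q u v} → Looping E _≺_ β Q → Between E _≺_ β Q u v →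
                             parity (walkLength Q) ≡ κ u ℙ.+ κ v
    looping-parity-between L (inj₁ Q∶u⇝v) = looping-parity L Q∶u⇝v
    looping-parity-between {u = u} {v} L (inj₂ Q∶v⇝u) =
      trans (looping-parity L Q∶v⇝u) (ℙ.+-comm (κ v) (κ u))

    looping-length-+-even : ∀ {Q Q′ u v} →
                            Looping E _≺_ β Q → Between E _≺_ β Q u v →
                            Looping E _≺_ β Q′ → Between E _≺_ β Q′ u v →
                            2 ℕ.∣ walkLength Q ℕ.+ walkLength Q′
    looping-length-+-even {Q} {Q′} {u} {v} L B L′ B′ = parity≡0ℙ⇒2∣ _ (begin
      parity (walkLength Q ℕ.+ walkLength Q′)
        ≡⟨ +-homo-+ (walkLength Q) (walkLength Q′) ⟩
      parity (walkLength Q) ℙ.+ parity (walkLength Q′)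
        ≡⟨ cong₂ ℙ._+_ (looping-parity-between L B) (looping-parity-between L′ B′) ⟩
      (κ u ℙ.+ κ v) ℙ.+ (κ u ℙ.+ κ v)
        ≡⟨ p+p≡0ℙ (κ u ℙ.+ κ v) ⟩
      0ℙ
        ∎)
      where open ≡-Reasoning

lemma20 : (n : ℕ) (E : Fin n → Fin n → Set) (_≺_ : Fin n → Fin n → Set) (β : Fin n → ℕ) →
          IsSimpleGraph E → IsBipartite E → IsStrictTotalOrder _≡_ _≺_ →
          (∀ v → β v ≡ 1 ⊎ β v ≡ 2) →
          (Q : List (Fin n)) (u v : Fin n) →
          Looping E _≺_ β Q → Between E _≺_ β Q u v →
          (d : ℤ) → IsDelta E _≺_ β u v d →
          (+ 2) ∣ (lam E _≺_ β Q + d)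
lemma20 n E _≺_ β _ (colour , proper) _ _ Q u v L B d ((Q′ , L′ , B′ , refl) , _) =
  lam-+-even E _≺_ β Q Q′
    (looping-length-+-even E _≺_ β (λ x → boolToParity (colour x))
      (λ {x} {y} xy → boolToParity-≢ (proper x y xy)) L B L′ B′)
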